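{- Let $e$ be a resource expression, $\bar t$ a resource monomial, $e'\in\mathrm{supp}(\partial_xe\cdot\bar t)$ and $r'$ a rigid expression with $r'\lhd e'$. Then $n_x(e)=|\bar t|$ and there exist a rigid expression $r\lhd e$ and a rigid monomial $\vec b\lhd\bar t$ such that $r'=r[\vec b/x]$.
   Context: Resource terms and monomials: $s,t ::= x\mid\lambda x.s\mid\langle s\rangle\bar t\mid s\oplus\bullet\mid\bullet\oplus s$, $\bar t::=[t_1,\dots,t_n]$ (finite multisets; $|\bar t|=n$), up to $\alpha$-equivalence. Finite formal sums with coefficients in $\mathbb N$, $\mathrm{supp}$ the support; constructors extended by multilinearity. $n_x(e)$ is the number of free occurrences of $x$. For $\bar u=[u_1,\dots,u_n]$, $\partial_xe\cdot\bar u$: $\partial_xy\cdot\bar u$ is $y$ if $y\ne x$ and $n=0$, $u_1$ if $y=x$ and $n=1$, $0$ otherwise; $\partial_x(\lambda y.s)\cdot\bar u=\lambda y.(\partial_xs\cdot\bar u)$ ($y$ fresh), $\partial_x(s\oplus\bullet)\cdot\bar u=(\partial_xs\cdot\bar u)\oplus\bullet$, $\partial_x(\bullet\oplus s)\cdot\bar u=\bullet\oplus(\partial_xs\cdot\bar u)$; $\partial_x(\langle s\rangle\bar t)\cdot\bar u=\sum_{(I_1,I_2)}\langle\partial_xs\cdot\bar u_{I_1}\rangle(\partial_x\bar t\cdot\bar u_{I_2})$; $\partial_x[t_1,\dots,t_k]\cdot\bar u=\sum_{(I_1,\dots,I_k)}[\partial_xt_1\cdot\bar u_{I_1},\dots,\partial_xt_k\cdot\bar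 u_{I_k}]$, sums over tuples of pairwise disjoint possibly empty subsets of $\{1,\dots,n\}$ covering it, $\bar u_I=[u_i\mid i\in I]$. Rigid terms and monomials: $a,b,c ::= x\mid\lambda x.a\mid\langle a\rangle\vec b\mid a\oplus\bullet\mid\bullet\oplus a$, $\vec b::=(b_1,\dots,b_n)$ (finite lists; $|\vec b|=n$, $::$ concatenation). $\underline r$ replaces recursively each list by the multiset of its elements; $r\lhd e$ means $\underline r=e$. Rigid substitution, for $|\vec b|=n_x(r)$: $x[(b)/x]=b$, $y[()/x]=y$ ($y\ne x$), $(\lambda z.a)[\vec b/x]=\lambda z.a[\vec b/x]$ ($z$ fresh), $(a\oplus\bullet)[\vec b/x]=a[\vec b/x]\oplus\bullet$, $(\bullet\oplus a)[\vec b/x]=\bullet\oplus a[\vec b/x]$, $(\langle c\rangle\vec d)[\vec b_0::\vec b_1/x]=\langle c[\vec b_0/x]\rangle\vec d[\vec b_1/x]$ with $|\vec b_0|=n_x(c)$, $|\vec b_1|=n_x(\vec d)$, $(a_1,\dots,a_n)[\vec b_1::\cdots::\vec b_n/x]=(a_1[\vec b_1/x],\dots,a_n[\vec b_n/x])$ with $|\vec b_i|=n_x(a_i)$. -}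

module Defs where

open import Data.Nat using (ℕ; zero; suc; _+_; _<ᵇ_; _≡ᵇ_)
open import Data.Bool using (Bool; true; false; if_then_else_)
open import Data.List using (List; []; _∷_; concatMap; map; [_])
open import Data.List.Relation.Unary.Any using (Any)
open import Data.Product using (_×_; _,_)
open import Relation.Binary.PropositionalEquality using (_≡_; _≢_)

-- Conventions
--  * Variables are de Bruijn indices (ℕ); this realises terms "up to
--    α-equivalence".  λ binds index 0; a free variable x seen under a λ
--    becomes x+1; "y fresh" in the paper becomes weakening (wk) of the
--    arguments pushed under a binder.
--  * An expression is either a term (kind tm) or a monomial (kind mon).

data Kind : Set where
  tm mon : Kind

-- A bag [t₁,…,tₙ] is represented by a list; bags
-- are finite multisets, so resource expressions are considered modulo
-- the congruence _≈_ below (permutation of bag elements, at all depths).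

data Rs : Kind → Set where
  var    : ℕ → Rs tm
  lam    : Rs tm → Rs tm
  app    : Rs tm → Rs mon → Rs tm
  _⊕•    : Rs tm → Rs tm
  •⊕_    : Rs tm → Rs tm
  []     : Rs mon
  _∷_    : Rs tm → Rs mon → Rs mon

infixr 5 _∷_

data _≈_ : {k : Kind} → Rs k → Rs k → Set where
  var   : ∀ {i} → var i ≈ var i
  lam   : ∀ {s s'} → s ≈ s' → lam s ≈ lam s'
  app   : ∀ {s s' t t'} → s ≈ s' → t ≈ t' → app s t ≈ app s' t'
  ≈⊕•   : ∀ {s s'} → s ≈ s' → (s ⊕•) ≈ (s' ⊕•)
  ≈•⊕   : ∀ {s s'} → s ≈ s' → (•⊕ s) ≈ (•⊕ s')
  nil   : [] ≈ []
  cons  : ∀ {s s' t t'} → s ≈ s' → t ≈ t' → (s ∷ t) ≈ (s' ∷ t')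
  swap  : ∀ {s s' t} → (s ∷ s' ∷ t) ≈ (s' ∷ s ∷ t)
  trans : ∀ {k} {a b c : Rs k} → a ≈ b → b ≈ c → a ≈ c

size : Rs mon → ℕ
size []      = 0
size (_ ∷ t) = suc (size t)

nfree : ∀ {k} → ℕ → Rs k → ℕ
nfree x (var y)  = if x ≡ᵇ y then 1 else 0
nfree x (lam s)  = nfree (suc x) s
nfree x (app s t) = nfree x s + nfree x t
nfree x (s ⊕•)   = nfree x s
nfree x (•⊕ s)   = nfree x s
nfree x []       = 0
nfree x (s ∷ t)  = nfree x s + nfree x t

wk : ∀ {k} → ℕ → Rs k → Rs k
wk c (var y)   = if y <ᵇ c then var y else var (suc y)
wk c (lam s)   = lam (wk (suc c) s)
wk c (app s t) = app (wk c s) (wk c t)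
wk c (s ⊕•)    = wk c s ⊕•
wk c (•⊕ s)    = •⊕ wk c s
wk c []        = []
wk c (s ∷ t)   = wk c s ∷ wk c t

-- Finite formal sums with coefficients in ℕ: a list of summands (with
-- repetitions).  0 is the empty list.  The support is the set of
-- (≈-classes of) summands.

Sum : Kind → Set
Sum k = List (Rs k)

_∈supp_ : ∀ {k} → Rs k → Sum k → Set
e ∈supp S = Any (e ≈_) S

splits : Rs mon → List (Rs mon × Rs mon)
splits []      = [ ([] , []) ]
splits (u ∷ ū) = concatMap (λ { (A , B) → (u ∷ A , B) ∷ (A , u ∷ B) ∷ [] }) (splits ū)

∂ : ∀ {k} → ℕ → Rs k → Rs mon → Sum k
∂ x (var y) []            = if x ≡ᵇ y then [] else [ var y ]
∂ x (var y) (u ∷ [])      = if x ≡ᵇ y then [ u ] else []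
∂ x (var y) (_ ∷ _ ∷ _)   = []
∂ x (lam s) ū             = map lam (∂ (suc x) s (wk 0 ū))
∂ x (app s t) ū           =
  concatMap (λ { (A , B) → concatMap (λ s' → map (app s') (∂ x t B)) (∂ x s A) }) (splits ū)
∂ x (s ⊕•) ū              = map _⊕• (∂ x s ū)
∂ x (•⊕ s) ū              = map •⊕_ (∂ x s ū)
∂ x [] []                 = [ [] ]
∂ x [] (_ ∷ _)            = []
∂ x (t ∷ t̄) ū             =
  concatMap (λ { (A , B) → concatMap (λ t' → map (t' ∷_) (∂ x t̄ B)) (∂ x t A) }) (splits ū)

-- Rigid expressions: same grammar, lists instead of multisets
-- (no quotient).

data Rg : Kind → Set where
  rvar  : ℕ → Rg tm
  rlam  : Rg tm → Rg tm
  rapp  : Rg tm → Rg mon → Rg tm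
  r⊕•   : Rg tm → Rg tm
  r•⊕   : Rg tm → Rg tm
  rnil  : Rg mon
  rcons : Rg tm → Rg mon → Rg mon

_++ʳ_ : Rg mon → Rg mon → Rg mon
rnil ++ʳ b       = b
rcons a as ++ʳ b = rcons a (as ++ʳ b)

rwk : ∀ {k} → ℕ → Rg k → Rg k
rwk c (rvar y)    = if y <ᵇ c then rvar y else rvar (suc y)
rwk c (rlam a)    = rlam (rwk (suc c) a)
rwk c (rapp a b)  = rapp (rwk c a) (rwk c b)
rwk c (r⊕• a)     = r⊕• (rwk c a)
rwk c (r•⊕ a)     = r•⊕ (rwk c a)
rwk c rnil        = rnil
rwk c (rcons a b) = rcons (rwk c a) (rwk c b)

⌊_⌋ : ∀ {k} → Rg k → Rs k
⌊ rvar y ⌋    = var y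
⌊ rlam a ⌋    = lam ⌊ a ⌋
⌊ rapp a b ⌋  = app ⌊ a ⌋ ⌊ b ⌋
⌊ r⊕• a ⌋     = ⌊ a ⌋ ⊕•
⌊ r•⊕ a ⌋     = •⊕ ⌊ a ⌋
⌊ rnil ⌋      = []
⌊ rcons a b ⌋ = ⌊ a ⌋ ∷ ⌊ b ⌋

_◁_ : ∀ {k} → Rg k → Rs k → Set
r ◁ e = ⌊ r ⌋ ≈ e

-- Rigid substitution as a relation:  RSubst x a b⃗ c  means
-- a[b⃗/x] is defined (so |b⃗| = n_x(a)) and equals c.
data RSubst (x : ℕ) : ∀ {k} → Rg k → Rg mon → Rg k → Set where
  sVar   : ∀ {b} → RSubst x (rvar x) (rcons b rnil) b
  sVar≢  : ∀ {y} → y ≢ x → RSubst x (rvar y) rnil (rvar y)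
  sLam   : ∀ {a b⃗ c} → RSubst (suc x) a (rwk 0 b⃗) c → RSubst x (rlam a) b⃗ (rlam c)
  s⊕•    : ∀ {a b⃗ c} → RSubst x a b⃗ c → RSubst x (r⊕• a) b⃗ (r⊕• c)
  s•⊕    : ∀ {a b⃗ c} → RSubst x a b⃗ c → RSubst x (r•⊕ a) b⃗ (r•⊕ c)
  sApp   : ∀ {c d b₀ b₁ c' d'} → RSubst x c b₀ c' → RSubst x d b₁ d' →
           RSubst x (rapp c d) (b₀ ++ʳ b₁) (rapp c' d')
  sNil   : RSubst x rnil rnil rnil
  sCons  : ∀ {a as b₀ b₁ a' as'} → RSubst x a b₀ a' → RSubst x as b₁ as' →
           RSubst x (rcons a as) (b₀ ++ʳ b₁) (rcons a' as')

--  * Decomposition (by induction on e, following the definition of ∂):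
--    every summand s of ∂_x e · ū has its canonical rigid representative
--    ⌈ s ⌉ decomposable, and n_x(e) = |ū|.  Each constructor of e is
--    handled by a closure property of Decomp; the binder case needs the
--    fact that bag equality reflects weakening, the binary cases need that
--    the two halves of a split of ū recombine to ū up to permutation.
--  * Transport (by induction on e₁ ≈ e₂): decomposability of ⌈ e₁ ⌉ is
--    inherited by ⌈ e₂ ⌉.  A swap of two bag elements is matched by swapping
--    the corresponding blocks of the argument list b⃗.
--
-- Since ⌈ ⌊ r' ⌋ ⌉ = r', the theorem follows by transporting along
-- s ≈ e' ≈ ⌊ r' ⌋.
module Submission where

open import Defs
open import Data.Nat using (ℕ; suc; _+_; _<ᵇ_; _≡ᵇ_)
open import Data.Nat.Properties using (≡ᵇ⇒≡; ≡⇒≡ᵇ; +-suc)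
open import Data.Bool using (true; false; T)
open import Data.Unit using (tt)
open import Data.List using (List; concatMap; map)
open import Data.List.Membership.Propositional using (_∈_; find)
open import Data.List.Membership.Propositional.Properties using (∈-map⁻; ∈-concatMap⁻)
open import Data.List.Relation.Unary.Any using (here; there)
open import Data.Product using (Σ; ∃; ∃₂; _×_; _,_; proj₂)
open import Relation.Binary.PropositionalEquality using (_≡_; refl; sym; cong; cong₂; subst) renaming (trans to ≡-trans)

≈-refl : ∀ {k} {e : Rs k} → e ≈ e
≈-refl {e = var x}   = var
≈-refl {e = lam e}   = lam ≈-refl
≈-refl {e = app s t} = app ≈-refl ≈-refl
≈-refl {e = s ⊕•}    = ≈⊕• ≈-refl
≈-refl {e = •⊕ s}    = ≈•⊕ ≈-refl
≈-refl {e = []}      = nil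
≈-refl {e = s ∷ t}   = cons ≈-refl ≈-refl

≈-sym : ∀ {k} {a b : Rs k} → a ≈ b → b ≈ a
≈-sym var          = var
≈-sym (lam d)      = lam (≈-sym d)
≈-sym (app d d')   = app (≈-sym d) (≈-sym d')
≈-sym (≈⊕• d)      = ≈⊕• (≈-sym d)
≈-sym (≈•⊕ d)      = ≈•⊕ (≈-sym d)
≈-sym nil          = nil
≈-sym (cons d d')  = cons (≈-sym d) (≈-sym d')
≈-sym swap         = swap
≈-sym (trans d d') = trans (≈-sym d') (≈-sym d)

≡⇒≈ : ∀ {k} {a b : Rs k} → a ≡ b → a ≈ b
≡⇒≈ refl = ≈-refl

_++ᵇ_ : Rs mon → Rs mon → Rs mon
[]       ++ᵇ v = v
(a ∷ u)  ++ᵇ v = a ∷ (u ++ᵇ v)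

infixr 5 _++ᵇ_

++ᵇ-congˡ : ∀ {u u'} v → u ≈ u' → (u ++ᵇ v) ≈ (u' ++ᵇ v)
++ᵇ-congˡ v nil          = ≈-refl
++ᵇ-congˡ v (cons d d')  = cons d (++ᵇ-congˡ v d')
++ᵇ-congˡ v swap         = swap
++ᵇ-congˡ v (trans d d') = trans (++ᵇ-congˡ v d) (++ᵇ-congˡ v d')

++ᵇ-congʳ : ∀ u {v v'} → v ≈ v' → (u ++ᵇ v) ≈ (u ++ᵇ v')
++ᵇ-congʳ []      d = d
++ᵇ-congʳ (a ∷ u) d = cons ≈-refl (++ᵇ-congʳ u d)

++ᵇ-cong : ∀ {u u' v v'} → u ≈ u' → v ≈ v' → (u ++ᵇ v) ≈ (u' ++ᵇ v')
++ᵇ-cong {u' = u'} {v = v} d d' = trans (++ᵇ-congˡ v d) (++ᵇ-congʳ u' d')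

∷-++ᵇ : ∀ a u v → (a ∷ (u ++ᵇ v)) ≈ (u ++ᵇ (a ∷ v))
∷-++ᵇ a []      v = ≈-refl
∷-++ᵇ a (c ∷ u) v = trans swap (cons ≈-refl (∷-++ᵇ a u v))

++ᵇ-exchange : ∀ u v w → (u ++ᵇ v ++ᵇ w) ≈ (v ++ᵇ u ++ᵇ w)
++ᵇ-exchange []      v w = ≈-refl
++ᵇ-exchange (a ∷ u) v w = trans (cons ≈-refl (++ᵇ-exchange u v w)) (∷-++ᵇ a v (u ++ᵇ w))

∈-concatMap-find : ∀ {A B : Set} (f : A → List B) (xs : List A) {y} →
                   y ∈ concatMap f xs → ∃ λ a → a ∈ xs × y ∈ f a
∈-concatMap-find f xs y∈ = find (∈-concatMap⁻ f y∈)

splits-sound : ∀ u {A B} → (A , B) ∈ splits u → (size A + size B ≡ size u) × ((A ++ᵇ B) ≈ u)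
splits-sound []      (here refl) = refl , nil
splits-sound (v ∷ u) AB∈ with ∈-concatMap-find _ (splits u) AB∈
... | (A , B) , AB∈′ , here refl with splits-sound u AB∈′
...   | sizes , perm = cong suc sizes , cons ≈-refl perm
splits-sound (v ∷ u) AB∈ | (A , B) , AB∈′ , there (here refl) with splits-sound u AB∈′
...   | sizes , perm = ≡-trans (+-suc (size A) (size B)) (cong suc sizes)
                     , trans (≈-sym (∷-++ᵇ v A B)) (cons ≈-refl perm)

⌈_⌉ : ∀ {k} → Rs k → Rg k
⌈ var y ⌉   = rvar y
⌈ lam s ⌉   = rlam ⌈ s ⌉
⌈ app s t ⌉ = rapp ⌈ s ⌉ ⌈ t ⌉
⌈ s ⊕• ⌉    = r⊕• ⌈ s ⌉
⌈ •⊕ s ⌉    = r•⊕ ⌈ s ⌉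
⌈ [] ⌉      = rnil
⌈ s ∷ t ⌉   = rcons ⌈ s ⌉ ⌈ t ⌉

⌊⌈⌉⌋ : ∀ {k} (e : Rs k) → ⌊ ⌈ e ⌉ ⌋ ≡ e
⌊⌈⌉⌋ (var y)   = refl
⌊⌈⌉⌋ (lam s)   = cong lam (⌊⌈⌉⌋ s)
⌊⌈⌉⌋ (app s t) = cong₂ app (⌊⌈⌉⌋ s) (⌊⌈⌉⌋ t)
⌊⌈⌉⌋ (s ⊕•)    = cong _⊕• (⌊⌈⌉⌋ s)
⌊⌈⌉⌋ (•⊕ s)    = cong •⊕_ (⌊⌈⌉⌋ s)
⌊⌈⌉⌋ []        = refl
⌊⌈⌉⌋ (s ∷ t)   = cong₂ _∷_ (⌊⌈⌉⌋ s) (⌊⌈⌉⌋ t)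

⌈⌊⌋⌉ : ∀ {k} (r : Rg k) → ⌈ ⌊ r ⌋ ⌉ ≡ r
⌈⌊⌋⌉ (rvar y)    = refl
⌈⌊⌋⌉ (rlam s)    = cong rlam (⌈⌊⌋⌉ s)
⌈⌊⌋⌉ (rapp s t)  = cong₂ rapp (⌈⌊⌋⌉ s) (⌈⌊⌋⌉ t)
⌈⌊⌋⌉ (r⊕• s)     = cong r⊕• (⌈⌊⌋⌉ s)
⌈⌊⌋⌉ (r•⊕ s)     = cong r•⊕ (⌈⌊⌋⌉ s)
⌈⌊⌋⌉ rnil        = refl
⌈⌊⌋⌉ (rcons s t) = cong₂ rcons (⌈⌊⌋⌉ s) (⌈⌊⌋⌉ t)

⌊⌋-injective : ∀ {k} {r r' : Rg k} → ⌊ r ⌋ ≡ ⌊ r' ⌋ → r ≡ r'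
⌊⌋-injective {r = r} {r'} eq = ≡-trans (sym (⌈⌊⌋⌉ r)) (≡-trans (cong ⌈_⌉ eq) (⌈⌊⌋⌉ r'))

⌊rwk⌋ : ∀ {k} c (r : Rg k) → ⌊ rwk c r ⌋ ≡ wk c ⌊ r ⌋
⌊rwk⌋ c (rvar y) with y <ᵇ c
... | true  = refl
... | false = refl
⌊rwk⌋ c (rlam s)    = cong lam (⌊rwk⌋ (suc c) s)
⌊rwk⌋ c (rapp s t)  = cong₂ app (⌊rwk⌋ c s) (⌊rwk⌋ c t)
⌊rwk⌋ c (r⊕• s)     = cong _⊕• (⌊rwk⌋ c s)
⌊rwk⌋ c (r•⊕ s)     = cong •⊕_ (⌊rwk⌋ c s)
⌊rwk⌋ c rnil        = refl
⌊rwk⌋ c (rcons s t) = cong₂ _∷_ (⌊rwk⌋ c s) (⌊rwk⌋ c t)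

⌊++ʳ⌋ : ∀ p q → ⌊ p ++ʳ q ⌋ ≡ (⌊ p ⌋ ++ᵇ ⌊ q ⌋)
⌊++ʳ⌋ rnil        q = refl
⌊++ʳ⌋ (rcons a p) q = cong (⌊ a ⌋ ∷_) (⌊++ʳ⌋ p q)

size-wk : ∀ c u → size (wk c u) ≡ size u
size-wk c []      = refl
size-wk c (a ∷ u) = cong suc (size-wk c u)

-- Bag equality reflects weakening: whatever is bag-equal to a weakened
-- expression is itself weakened, from a bag-equal expression.  This lets
-- argument lists be moved back out of a binder.

wk-var : ∀ c j → ∃ λ i → wk c (var j) ≡ var i
wk-var c j with j <ᵇ c
... | true  = j , refl
... | false = suc j , refl

≈-unweaken : ∀ {k} {f g : Rs k} c → f ≈ g → ∀ {f₀} → f ≡ wk c f₀ →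
             ∃ λ g₀ → (g ≡ wk c g₀) × (f₀ ≈ g₀)
≈-unweaken c var  {f₀} eq = f₀ , eq , ≈-refl
≈-unweaken c nil  {f₀} eq = f₀ , eq , ≈-refl
≈-unweaken c (trans d d') eq with ≈-unweaken c d eq
... | g₁ , eq₁ , d₀ with ≈-unweaken c d' eq₁
... | g₂ , eq₂ , d₀' = g₂ , eq₂ , trans d₀ d₀'
≈-unweaken c (lam _)   {var j} eq with () ← ≡-trans eq (proj₂ (wk-var c j))
≈-unweaken c (app _ _) {var j} eq with () ← ≡-trans eq (proj₂ (wk-var c j))
≈-unweaken c (≈⊕• _)   {var j} eq with () ← ≡-trans eq (proj₂ (wk-var c j))
≈-unweaken c (≈•⊕ _)   {var j} eq with () ← ≡-trans eq (proj₂ (wk-var c j))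
≈-unweaken c (lam d) {lam f₀} refl with ≈-unweaken (suc c) d refl
... | g₀ , refl , d₀ = lam g₀ , refl , lam d₀
≈-unweaken c (app d d') {app f₀ f₀'} refl with ≈-unweaken c d refl | ≈-unweaken c d' refl
... | g₀ , refl , d₀ | g₀' , refl , d₀' = app g₀ g₀' , refl , app d₀ d₀'
≈-unweaken c (≈⊕• d) {f₀ ⊕•} refl with ≈-unweaken c d refl
... | g₀ , refl , d₀ = g₀ ⊕• , refl , ≈⊕• d₀
≈-unweaken c (≈•⊕ d) {•⊕ f₀} refl with ≈-unweaken c d refl
... | g₀ , refl , d₀ = •⊕ g₀ , refl , ≈•⊕ d₀
≈-unweaken c (cons d d') {f₀ ∷ f₀'} refl with ≈-unweaken c d refl | ≈-unweaken c d' refl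
... | g₀ , refl , d₀ | g₀' , refl , d₀' = g₀ ∷ g₀' , refl , cons d₀ d₀'
≈-unweaken c swap {a ∷ b ∷ t} refl = b ∷ a ∷ t , refl , swap

◁-unweaken : ∀ {k} c {r : Rg k} {u : Rs k} → r ◁ wk c u → ∃ λ r₀ → (r ≡ rwk c r₀) × (r₀ ◁ u)
◁-unweaken c {r} {u} r◁ with ≈-unweaken c (≈-sym r◁) refl
... | g₀ , r≡ , d = ⌈ g₀ ⌉ , ⌊⌋-injective r-is-weakened , subst (_≈ u) (sym (⌊⌈⌉⌋ g₀)) (≈-sym d)
  where
  r-is-weakened : ⌊ r ⌋ ≡ ⌊ rwk c ⌈ g₀ ⌉ ⌋
  r-is-weakened = ≡-trans r≡ (sym (≡-trans (⌊rwk⌋ c ⌈ g₀ ⌉) (cong (wk c) (⌊⌈⌉⌋ g₀))))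

record Decomp {k} (x : ℕ) (e : Rs k) (ū : Rs mon) (r' : Rg k) : Set where
  constructor decomp
  field
    body   : Rg k
    args   : Rg mon
    body◁  : body ◁ e
    args◁  : args ◁ ū
    substs : RSubst x body args r'

decomp-self : ∀ {k x} {r : Rg k} {b r'} → RSubst x r b r' → Decomp x ⌊ r ⌋ ⌊ b ⌋ r'
decomp-self s = decomp _ _ ≈-refl ≈-refl s

decomp-≈ : ∀ {k x} {e e' : Rs k} {u u' r'} → e ≈ e' → u ≈ u' → Decomp x e u r' → Decomp x e' u' r'
decomp-≈ d d' (decomp r b r◁ b◁ s) = decomp r b (trans r◁ d) (trans b◁ d') s

decomp-lam : ∀ {x e u c} → Decomp (suc x) e (wk 0 u) c → Decomp x (lam e) u (rlam c)
decomp-lam (decomp r β r◁ β◁ s) with ◁-unweaken 0 β◁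
... | b , refl , b◁ = decomp (rlam r) b (lam r◁) b◁ (sLam s)

decomp-⊕• : ∀ {x e u c} → Decomp x e u c → Decomp x (e ⊕•) u (r⊕• c)
decomp-⊕• (decomp r b r◁ b◁ s) = decomp (r⊕• r) b (≈⊕• r◁) b◁ (s⊕• s)

decomp-•⊕ : ∀ {x e u c} → Decomp x e u c → Decomp x (•⊕ e) u (r•⊕ c)
decomp-•⊕ (decomp r b r◁ b◁ s) = decomp (r•⊕ r) b (≈•⊕ r◁) b◁ (s•⊕ s)

args-++ : ∀ {b₁ b₂ A B} → b₁ ◁ A → b₂ ◁ B → (b₁ ++ʳ b₂) ◁ (A ++ᵇ B)
args-++ {b₁} {b₂} b₁◁ b₂◁ = subst (_≈ _) (sym (⌊++ʳ⌋ b₁ b₂)) (++ᵇ-cong b₁◁ b₂◁)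

decomp-app : ∀ {x e t A B c d} → Decomp x e A c → Decomp x t B d → Decomp x (app e t) (A ++ᵇ B) (rapp c d)
decomp-app (decomp r₁ b₁ r₁◁ b₁◁ s₁) (decomp r₂ b₂ r₂◁ b₂◁ s₂) =
  decomp (rapp r₁ r₂) (b₁ ++ʳ b₂) (app r₁◁ r₂◁) (args-++ b₁◁ b₂◁) (sApp s₁ s₂)

decomp-cons : ∀ {x e t A B c d} → Decomp x e A c → Decomp x t B d → Decomp x (e ∷ t) (A ++ᵇ B) (rcons c d)
decomp-cons (decomp r₁ b₁ r₁◁ b₁◁ s₁) (decomp r₂ b₂ r₂◁ b₂◁ s₂) =
  decomp (rcons r₁ r₂) (b₁ ++ʳ b₂) (cons r₁◁ r₂◁) (args-++ b₁◁ b₂◁) (sCons s₁ s₂)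

∈-bilinear⁻ : ∀ {X Y Z : Set} (f : X → Y → Z) (xs : List X) (ys : List Y) {z} →
              z ∈ concatMap (λ x → map (f x) ys) xs → ∃₂ λ x y → x ∈ xs × y ∈ ys × z ≡ f x y
∈-bilinear⁻ f xs ys z∈ with ∈-concatMap-find _ xs z∈
... | x , x∈ , z∈′ with ∈-map⁻ (f x) z∈′
... | y , y∈ , refl = x , y , x∈ , y∈ , refl

decompose : ∀ {k} x (e : Rs k) (u : Rs mon) {s} → s ∈ ∂ x e u →
            (nfree x e ≡ size u) × Decomp x e u ⌈ s ⌉
decompose x (var y) [] s∈ with x ≡ᵇ y in x≡ᵇy
decompose x (var y) [] (here refl) | false =
  refl , decomp (rvar y) rnil var nil (sVar≢ λ y≡x → subst T x≡ᵇy (≡⇒≡ᵇ x y (sym y≡x)))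
decompose x (var y) (u ∷ []) s∈ with x ≡ᵇ y in x≡ᵇy
decompose x (var y) (u ∷ []) (here refl) | true with ≡ᵇ⇒≡ x y (subst T (sym x≡ᵇy) tt)
... | refl = refl , decomp (rvar x) (rcons ⌈ u ⌉ rnil) var (cons (≡⇒≈ (⌊⌈⌉⌋ u)) nil) sVar
decompose x (lam e) u s∈ with ∈-map⁻ lam s∈
... | s , s∈′ , refl with decompose (suc x) e (wk 0 u) s∈′
... | count , D = ≡-trans count (size-wk 0 u) , decomp-lam D
decompose x (app e t) u s∈ with ∈-concatMap-find _ (splits u) s∈
... | (A , B) , AB∈ , s∈′ with ∈-bilinear⁻ app (∂ x e A) (∂ x t B) s∈′
... | s₁ , s₂ , s₁∈ , s₂∈ , refl with decompose x e A s₁∈ | decompose x t B s₂∈ | splits-sound u AB∈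
... | count₁ , D₁ | count₂ , D₂ | sizes , perm =
  ≡-trans (cong₂ _+_ count₁ count₂) sizes , decomp-≈ ≈-refl perm (decomp-app D₁ D₂)
decompose x (e ⊕•) u s∈ with ∈-map⁻ _⊕• s∈
... | s , s∈′ , refl with decompose x e u s∈′
... | count , D = count , decomp-⊕• D
decompose x (•⊕ e) u s∈ with ∈-map⁻ •⊕_ s∈
... | s , s∈′ , refl with decompose x e u s∈′
... | count , D = count , decomp-•⊕ D
decompose x [] [] (here refl) = refl , decomp rnil rnil nil nil sNil
decompose x (e ∷ t) u s∈ with ∈-concatMap-find _ (splits u) s∈
... | (A , B) , AB∈ , s∈′ with ∈-bilinear⁻ _∷_ (∂ x e A) (∂ x t B) s∈′
... | s₁ , s₂ , s₁∈ , s₂∈ , refl with decompose x e A s₁∈ | decompose x t B s₂∈ | splits-sound u AB∈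
... | count₁ , D₁ | count₂ , D₂ | sizes , perm =
  ≡-trans (cong₂ _+_ count₁ count₂) sizes , decomp-≈ ≈-refl perm (decomp-cons D₁ D₂)

decomp-var : ∀ {x} {e₁ e₂ : Rs tm} → e₁ ≈ e₂ → Decomp x (var x) (⌊ ⌈ e₁ ⌉ ⌋ ∷ []) ⌈ e₂ ⌉
decomp-var {e₁ = e₁} {e₂} d = decomp (rvar _) (rcons ⌈ e₂ ⌉ rnil) var (cons arg◁ nil) sVar
  where
  arg◁ : ⌊ ⌈ e₂ ⌉ ⌋ ≈ ⌊ ⌈ e₁ ⌉ ⌋
  arg◁ = trans (≡⇒≈ (⌊⌈⌉⌋ e₂)) (trans (≈-sym d) (≡⇒≈ (sym (⌊⌈⌉⌋ e₁))))

args-exchange : ∀ p q w → (q ++ʳ (p ++ʳ w)) ◁ ⌊ p ++ʳ (q ++ʳ w) ⌋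
args-exchange p q w =
  trans (≡⇒≈ (⌊++ʳ⌋₃ q p w)) (trans (++ᵇ-exchange ⌊ q ⌋ ⌊ p ⌋ ⌊ w ⌋) (≡⇒≈ (sym (⌊++ʳ⌋₃ p q w))))
  where
  ⌊++ʳ⌋₃ : ∀ u v w → ⌊ u ++ʳ (v ++ʳ w) ⌋ ≡ (⌊ u ⌋ ++ᵇ ⌊ v ⌋ ++ᵇ ⌊ w ⌋)
  ⌊++ʳ⌋₃ u v w = ≡-trans (⌊++ʳ⌋ u (v ++ʳ w)) (cong (⌊ u ⌋ ++ᵇ_) (⌊++ʳ⌋ v w))

rsubst-transport : ∀ {k x} {e₁ e₂ : Rs k} → e₁ ≈ e₂ → ∀ {r b} → RSubst x r b ⌈ e₁ ⌉ →
                   Decomp x ⌊ r ⌋ ⌊ b ⌋ ⌈ e₂ ⌉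
rsubst-transport (trans d₁ d₂) s with rsubst-transport d₁ s
... | decomp r₁ b₁ r₁◁ b₁◁ s₁ = decomp-≈ r₁◁ b₁◁ (rsubst-transport d₂ s₁)
rsubst-transport var s = decomp-self s
rsubst-transport nil s = decomp-self s
rsubst-transport d@(lam _)   sVar = decomp-var d
rsubst-transport d@(app _ _) sVar = decomp-var d
rsubst-transport d@(≈⊕• _)   sVar = decomp-var d
rsubst-transport d@(≈•⊕ _)   sVar = decomp-var d
rsubst-transport (lam d) {b = b} (sLam s) =
  decomp-lam (subst (λ w → Decomp _ _ w _) (⌊rwk⌋ 0 b) (rsubst-transport d s))
rsubst-transport (app d₁ d₂) (sApp {b₀ = b₁} {b₁ = b₂} s₁ s₂) =
  decomp-≈ ≈-refl (≡⇒≈ (sym (⌊++ʳ⌋ b₁ b₂))) (decomp-app (rsubst-transport d₁ s₁) (rsubst-transport d₂ s₂))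
rsubst-transport (≈⊕• d) (s⊕• s) = decomp-⊕• (rsubst-transport d s)
rsubst-transport (≈•⊕ d) (s•⊕ s) = decomp-•⊕ (rsubst-transport d s)
rsubst-transport (cons d₁ d₂) (sCons {b₀ = b₁} {b₁ = b₂} s₁ s₂) =
  decomp-≈ ≈-refl (≡⇒≈ (sym (⌊++ʳ⌋ b₁ b₂))) (decomp-cons (rsubst-transport d₁ s₁) (rsubst-transport d₂ s₂))
rsubst-transport swap (sCons {a = a} {b₀ = p} sa (sCons {a = a'} {as = t} {b₀ = q} {b₁ = w} sa' st)) =
  decomp (rcons a' (rcons a t)) (q ++ʳ (p ++ʳ w)) swap (args-exchange p q w) (sCons sa' (sCons sa st))

decomp-transport : ∀ {k x} {e₁ e₂ : Rs k} {e u} → e₁ ≈ e₂ → Decomp x e u ⌈ e₁ ⌉ → Decomp x e u ⌈ e₂ ⌉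
decomp-transport d (decomp r b r◁ b◁ s) = decomp-≈ r◁ b◁ (rsubst-transport d s)

lemma5p7 : ∀ {k : Kind} (x : ℕ) (e : Rs k) (t̄ : Rs mon) (e' : Rs k) (r' : Rg k) →
    e' ∈supp ∂ x e t̄ → r' ◁ e' →
    (nfree x e ≡ size t̄) ×
    Σ (Rg k) (λ r → Σ (Rg mon) (λ b⃗ → (r ◁ e) × (b⃗ ◁ t̄) × RSubst x r b⃗ r'))
lemma5p7 x e t̄ e' r' e'∈ r'◁e' =
  let s , s∈ , e'≈s = find e'∈
      count , D     = decompose x e t̄ s∈
      D'            = decomp-transport (≈-sym (trans r'◁e' e'≈s)) D
      decomp r b r◁e b◁t̄ r[b] = subst (Decomp x e t̄) (⌈⌊⌋⌉ r') D'
  in  count , r , b , r◁e , b◁t̄ , r[b]
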